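{- Let $d,k,m \geq 2$ be integers and let $C_{d,k,m}$ denote the number of collinear $k$-tuples of points in $[m]^d$. Then \[ C_{d,k,m} = \begin{cases} O(m^{d+k-1}) & \text{ if } k \geq d+ 2, \\ O(m^{d+k-1} \log m ) & \text{ if } k = d+1, \\ O(m^{2d}) & \text{ if } d \geq k, \end{cases}\] where the implicit constants may depend on $d$ and $k$ but not on $m$.
   Context: For a positive integer $m$, $[m]=\{0,1,\ldots,m-1\}$, and $[m]^d$ is the $d$-dimensional integer grid. A collinear $k$-tuple in $[m]^d$ is a $k$-tuple of distinct points of $[m]^d$ all lying on a common line. -}

module Defs where

open import Data.Nat using (ℕ; _+_; _*_; _^_; _≤_)
open import Data.Fin using (Fin; toℕ)
open import Data.Vec using (Vec; lookup; map; zipWith; replicate)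
open import Data.List using (List; length)
open import Data.List.Relation.Unary.All using (All)
open import Data.List.Relation.Unary.Unique.Propositional using (Unique)
open import Data.Rational using (ℚ; 0ℚ) renaming (_+_ to _+ℚ_; _*_ to _*ℚ_)
import Data.Rational as Q
open import Data.Integer using (+_)
open import Data.Product using (Σ; _×_)
open import Relation.Binary.PropositionalEquality using (_≡_; _≢_)

-- A point of the grid [m]^d = {0,…,m-1}^d
Point : ℕ → ℕ → Set
Point d m = Vec (Fin m) d

Tuple : ℕ → ℕ → ℕ → Set
Tuple d k m = Vec (Point d m) k

toℚᵈ : ∀ {d m} → Point d m → Vec ℚ d
toℚᵈ p = map (λ x → (+ (toℕ x)) Q./ 1) p

-- A line in ℚ^d : { a + s v | s ∈ ℚ } with v ≠ 0.
-- (Any line of ℝ^d containing two distinct rational points is of this form,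
--  so for k ≥ 2 distinct grid points this is the usual collinearity.)
OnLine : ∀ {d} → Vec ℚ d → Vec ℚ d → Vec ℚ d → Set
OnLine a v x = Σ ℚ λ s → x ≡ zipWith _+ℚ_ a (map (λ vi → s *ℚ vi) v)

Collinear : ∀ {d k m} → Tuple d k m → Set
Collinear {d} {k} t =
  Σ (Vec ℚ d) λ a → Σ (Vec ℚ d) λ v →
    (v ≢ replicate d 0ℚ) × ((i : Fin k) → OnLine a v (toℚᵈ (lookup t i)))

Distinct : ∀ {d k m} → Tuple d k m → Set
Distinct {k = k} t = (i j : Fin k) → i ≢ j → lookup t i ≢ lookup t j

CollinearTuple : ∀ {d k m} → Tuple d k m → Set
CollinearTuple t = Distinct t × Collinear t

-- "C_{d,k,m} ≤ B": every duplicate-free list of collinear k-tuples of [m]^d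
-- has length at most B (equivalently, the number of collinear k-tuples is ≤ B).
CountAtMost : ℕ → ℕ → ℕ → ℕ → Set
CountAtMost d k m B =
  (L : List (Tuple d k m)) → Unique L → All CollinearTuple L → length L ≤ B

BigO : ℕ → ℕ → (ℕ → ℕ) → Set
BigO d k f = Σ ℕ λ C → (m : ℕ) → 2 ≤ m → CountAtMost d k m (C * f m)

-- The k points of a collinear tuple are p₀ and p₀ + tᵢ v (1 ≤ i < k), where v ∈ ℤ^d is the primitive
-- direction of their line and tᵢ ∈ ℤ. If 2^j ≤ ‖v‖∞ < 2^(j+1), then |tᵢ| 2^j ≤ |tᵢ| ‖v‖∞ < m, so the
-- tuple is determined by a code (p₀, v, t) taken from a set of size O(m^d (2^j)^d (m/2^j)^(k-1)).
-- Summing over the scales 2^j ≤ m gives a geometric sum dominated by its first term when k - 1 > d and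
-- by its last term when k - 1 < d, and a sum of about log₂ m equal terms when k - 1 = d.

module Submission where

open import Defs
open import Data.Nat
open import Data.Nat.Properties
open import Data.Nat.DivMod using (_/_; m/n*n≤m; m*n/n≡m; /-monoˡ-≤; m≥n⇒m/n>0; n/1≡n)
open import Data.Nat.Divisibility using (_∣_; divides; ∣-trans; _∣0; 0∣⇒≡0)
open import Data.Nat.GCD using (gcd; gcd[m,n]∣m; gcd[m,n]∣n; gcd-greatest; c*gcd[m,n]≡gcd[cm,cn])
open import Data.Nat.Logarithm using (⌊log₂_⌋; ⌊log₂⌋-mono-≤; ⌊log₂[2^n]⌋≡n)
open import Data.Nat.Tactic.RingSolver using (solve-∀)
open import Data.Integer as ℤ using (ℤ; -[1+_]; 0ℤ; ∣_∣; _⊖_)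
import Data.Integer.Properties as ℤ
import Data.Integer.Divisibility.Signed as ℤ
open import Data.Integer.Tactic.RingSolver using () renaming (solve-∀ to solve-∀ℤ)
open import Data.Rational as ℚ using (ℚ; toℚᵘ)
open import Data.Rational.Properties using (toℚᵘ-injective; toℚᵘ-fromℚᵘ; toℚᵘ-homo-+; toℚᵘ-homo-*)
open import Data.Rational.Solver using (module +-*-Solver)
open import Data.Rational.Unnormalised as ℚᵘ using (mkℚᵘ; *≡*)
import Data.Rational.Unnormalised.Properties as ℚᵘ
open import Data.Fin using (Fin; zero; suc; toℕ)
open import Data.Fin.Properties using (toℕ<n; toℕ-injective; ¬∀⟶∃¬)
open import Data.Vec as Vec using (Vec; []; _∷_; lookup; tabulate)
open import Data.Vec.Properties using (lookup-map; lookup-zipWith; lookup∘tabulate)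
open import Data.Vec.Relation.Binary.Pointwise.Extensional using (ext; Pointwise-≡⇒≡)
open import Data.List using (List; []; _∷_; length; map; _++_; upTo; allFin; cartesianProduct; cartesianProductWith)
open import Data.List.Properties using (length-map; length-++; length-upTo; length-tabulate; length-removeAt′)
open import Data.List.Relation.Unary.Any using (here; there)
import Data.List.Relation.Unary.All as All
open import Data.List.Relation.Unary.AllPairs using (_∷_)
open import Data.List.Relation.Unary.Unique.Propositional using (Unique)
open import Data.List.Membership.Propositional using (_∈_; _─_)
open import Data.List.Membership.Propositional.Properties
  using (∈-map⁺; ∈-++⁺ˡ; ∈-++⁺ʳ; ∈-upTo⁺; ∈-allFin; ∈-cartesianProductWith⁺; ∈-cartesianProduct⁺)
open import Data.List.Extrema ≤-totalOrder using (argmax; f[⊥]≤f[argmax]; f[xs]≤f[argmax])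
open import Data.Product using (∃-syntax; Σ-syntax; _×_; _,_; proj₁; proj₂)
open import Data.Sum using (inj₁; inj₂)
open import Function using (_∘_)
open import Relation.Binary.PropositionalEquality
open import Relation.Nullary using (¬_; contradiction)

private variable
  A B C : Set

^-distribʳ-* : ∀ m n o → (m * n) ^ o ≡ m ^ o * n ^ o
^-distribʳ-* m n zero    = refl
^-distribʳ-* m n (suc o) = begin
  m * n * (m * n) ^ o     ≡⟨ cong (m * n *_) (^-distribʳ-* m n o) ⟩
  m * n * (m ^ o * n ^ o) ≡⟨ [m*n]*[o*p]≡[m*o]*[n*p] m n (m ^ o) (n ^ o) ⟩
  m ^ suc o * n ^ suc o   ∎
  where open ≡-Reasoning

2*m≤n⇒2*m^[1+k]≤n^[1+k] : ∀ {m n} k → 2 * m ≤ n → 2 * m ^ suc k ≤ n ^ suc k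
2*m≤n⇒2*m^[1+k]≤n^[1+k] {m} {n} k 2m≤n = begin
  2 * (m * m ^ k) ≡⟨ *-assoc 2 m (m ^ k) ⟨
  2 * m * m ^ k   ≤⟨ *-mono-≤ 2m≤n (^-monoˡ-≤ k (≤-trans (m≤n*m m 2) 2m≤n)) ⟩
  n * n ^ k       ∎
  where open ≤-Reasoning

k*n+1≤[1+k]*n : ∀ k {n} → 1 ≤ n → k * n + 1 ≤ suc k * n
k*n+1≤[1+k]*n k {n} 1≤n = ≤-trans (+-monoʳ-≤ (k * n) 1≤n) (≤-reflexive (+-comm (k * n) n))

dyadic-scale : ∀ n → 1 ≤ n → ∃[ j ] 2 ^ j ≤ n × n < 2 ^ suc j
dyadic-scale 1 _ = 0 , ≤-refl , s≤s (s≤s z≤n)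
dyadic-scale (suc (suc n)) _ with dyadic-scale (suc n) (s≤s z≤n)
... | j , 2^j≤n , n<2^[1+j] with m≤n⇒m<n∨m≡n n<2^[1+j]
...   | inj₁ n+1<2^[1+j] = j , m≤n⇒m≤1+n 2^j≤n , n+1<2^[1+j]
...   | inj₂ n+1≡2^[1+j] = suc j , ≤-reflexive (sym n+1≡2^[1+j]) ,
          subst (_< 2 ^ suc (suc j)) (sym n+1≡2^[1+j]) (^-monoʳ-< 2 (s≤s (s≤s z≤n)) (n<1+n (suc j)))

2^j<2^[1+J]⇒j≤J : ∀ {j J} → 2 ^ j < 2 ^ suc J → j ≤ J
2^j<2^[1+J]⇒j≤J 2^j<2^[1+J] = ≮⇒≥ λ J<j → <⇒≱ 2^j<2^[1+J] (^-monoʳ-≤ 2 J<j)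

2^J≤m⇒1+J≤2*⌊log₂m⌋ : ∀ {m} J → 2 ≤ m → 2 ^ J ≤ m → suc J ≤ 2 * ⌊log₂ m ⌋
2^J≤m⇒1+J≤2*⌊log₂m⌋ {m} J 2≤m 2^J≤m = begin
  1 + J                  ≤⟨ +-mono-≤ (⌊log₂⌋-mono-≤ 2≤m) (subst (_≤ ⌊log₂ m ⌋) (⌊log₂[2^n]⌋≡n J) (⌊log₂⌋-mono-≤ 2^J≤m)) ⟩
  ⌊log₂ m ⌋ + ⌊log₂ m ⌋  ≡⟨ cong (_+_ ⌊log₂ m ⌋) (+-identityʳ ⌊log₂ m ⌋) ⟨
  2 * ⌊log₂ m ⌋          ∎
  where open ≤-Reasoning

infixl 7 _/2^_
_/2^_ : ℕ → ℕ → ℕ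
m /2^ j = _/_ m (2 ^ j) {{m^n≢0 2 j}}

2^j*[m/2^j]≤m : ∀ m j → 2 ^ j * (m /2^ j) ≤ m
2^j*[m/2^j]≤m m j = ≤-trans (≤-reflexive (*-comm (2 ^ j) (m /2^ j))) (m/n*n≤m m (2 ^ j) {{m^n≢0 2 j}})

n*2^j≤m⇒n≤m/2^j : ∀ {m n} j → n * 2 ^ j ≤ m → n ≤ m /2^ j
n*2^j≤m⇒n≤m/2^j {m} {n} j n2^j≤m = begin
  n                 ≡⟨ m*n/n≡m n (2 ^ j) {{m^n≢0 2 j}} ⟨
  n * 2 ^ j /2^ j   ≤⟨ /-monoˡ-≤ (2 ^ j) {{m^n≢0 2 j}} n2^j≤m ⟩
  m /2^ j           ∎
  where open ≤-Reasoning

2^j≤m⇒m/2^j>0 : ∀ {m} j → 2 ^ j ≤ m → 0 < m /2^ j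
2^j≤m⇒m/2^j>0 j = m≥n⇒m/n>0 {{m^n≢0 2 j}}

2*[m/2^[1+j]]≤m/2^j : ∀ m j → 2 * (m /2^ suc j) ≤ m /2^ j
2*[m/2^[1+j]]≤m/2^j m j = n*2^j≤m⇒n≤m/2^j j (begin
  2 * (m /2^ suc j) * 2 ^ j   ≡⟨ lemma (m /2^ suc j) (2 ^ j) ⟩
  2 ^ suc j * (m /2^ suc j)   ≤⟨ 2^j*[m/2^j]≤m m (suc j) ⟩
  m                           ∎)
  where
    open ≤-Reasoning
    lemma : ∀ x y → 2 * x * y ≡ 2 * y * x
    lemma = solve-∀

∑≤ : ℕ → (ℕ → ℕ) → ℕ
∑≤ zero    f = f 0
∑≤ (suc J) f = f 0 + ∑≤ J (f ∘ suc)

∑≤-mono-≤ : ∀ J {f g} → (∀ j → j ≤ J → f j ≤ g j) → ∑≤ J f ≤ ∑≤ J g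
∑≤-mono-≤ zero    f≤g = f≤g 0 z≤n
∑≤-mono-≤ (suc J) f≤g = +-mono-≤ (f≤g 0 z≤n) (∑≤-mono-≤ J (λ j j≤J → f≤g (suc j) (s≤s j≤J)))

∑≤-distribˡ-* : ∀ J c f → ∑≤ J (λ j → c * f j) ≡ c * ∑≤ J f
∑≤-distribˡ-* zero    c f = refl
∑≤-distribˡ-* (suc J) c f =
  trans (cong (_+_ (c * f 0)) (∑≤-distribˡ-* J c (f ∘ suc))) (sym (*-distribˡ-+ c (f 0) _))

∑≤-const : ∀ J c → ∑≤ J (λ _ → c) ≡ suc J * c
∑≤-const zero    c = sym (+-identityʳ c)
∑≤-const (suc J) c = cong (_+_ c) (∑≤-const J c)

∑≤-halving : ∀ J {f} → (∀ j → 2 * f (suc j) ≤ f j) → ∑≤ J f ≤ 2 * f 0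
∑≤-halving zero    {f} _    = m≤m+n (f 0) _
∑≤-halving (suc J) {f} half = begin
  f 0 + ∑≤ J (f ∘ suc) ≤⟨ +-monoʳ-≤ (f 0) (∑≤-halving J (half ∘ suc)) ⟩
  f 0 + 2 * f 1        ≤⟨ +-monoʳ-≤ (f 0) (≤-trans (half 0) (m≤m+n (f 0) 0)) ⟩
  2 * f 0              ∎
  where open ≤-Reasoning

∑≤-doubling : ∀ J {f} → (∀ j → 2 * f j ≤ f (suc j)) → ∑≤ J f ≤ 2 * f J
∑≤-doubling J {f} double = ≤-trans (m≤m+n (∑≤ J f) (f 0)) (∑≤+head J double)
  where
    ∑≤+head : ∀ J {f} → (∀ j → 2 * f j ≤ f (suc j)) → ∑≤ J f + f 0 ≤ 2 * f J
    ∑≤+head zero    {f} _      = ≤-reflexive (cong (_+_ (f 0)) (sym (+-identityʳ (f 0))))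
    ∑≤+head (suc J) {f} double = begin
      f 0 + ∑≤ J (f ∘ suc) + f 0 ≡⟨ lemma (f 0) (∑≤ J (f ∘ suc)) ⟩
      ∑≤ J (f ∘ suc) + 2 * f 0   ≤⟨ +-monoʳ-≤ (∑≤ J (f ∘ suc)) (double 0) ⟩
      ∑≤ J (f ∘ suc) + f 1       ≤⟨ ∑≤+head J (double ∘ suc) ⟩
      2 * f (suc J)              ∎
      where
        open ≤-Reasoning
        lemma : ∀ a s → a + s + a ≡ s + 2 * a
        lemma = solve-∀

[2^j]^a*[m/2^j]^a≤m^a : ∀ m j a → (2 ^ j) ^ a * (m /2^ j) ^ a ≤ m ^ a
[2^j]^a*[m/2^j]^a≤m^a m j a =
  ≤-trans (≤-reflexive (sym (^-distribʳ-* (2 ^ j) (m /2^ j) a))) (^-monoˡ-≤ a (2^j*[m/2^j]≤m m j))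

private
  m^a*[2*m^b]≡2*m^[a+b] : ∀ m a b → m ^ a * (2 * m ^ b) ≡ 2 * m ^ (a + b)
  m^a*[2*m^b]≡2*m^[a+b] m a b =
    trans (lemma (m ^ a) (m ^ b)) (cong (2 *_) (sym (^-distribˡ-+-* m a b)))
    where
      lemma : ∀ x y → x * (2 * y) ≡ 2 * (x * y)
      lemma = solve-∀

∑≤-dyadic-steep : ∀ m a s J →
  ∑≤ J (λ j → (2 ^ j) ^ a * (m /2^ j) ^ suc (a + s)) ≤ 2 * m ^ suc (a + s)
∑≤-dyadic-steep m a s J = begin
  ∑≤ J (λ j → (2 ^ j) ^ a * (m /2^ j) ^ suc (a + s)) ≤⟨ ∑≤-mono-≤ J (λ j _ → split j) ⟩
  ∑≤ J (λ j → m ^ a * (m /2^ j) ^ suc s)            ≡⟨ ∑≤-distribˡ-* J (m ^ a) _ ⟩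
  m ^ a * ∑≤ J (λ j → (m /2^ j) ^ suc s)            ≤⟨ *-monoʳ-≤ (m ^ a) (∑≤-halving J halving) ⟩
  m ^ a * (2 * (m / 1) ^ suc s)                     ≡⟨ cong (λ x → m ^ a * (2 * x ^ suc s)) (n/1≡n m) ⟩
  m ^ a * (2 * m ^ suc s)                           ≡⟨ m^a*[2*m^b]≡2*m^[a+b] m a (suc s) ⟩
  2 * m ^ (a + suc s)                               ≡⟨ cong (λ e → 2 * m ^ e) (+-suc a s) ⟩
  2 * m ^ suc (a + s)                               ∎
  where
    open ≤-Reasoning
    halving : ∀ j → 2 * (m /2^ suc j) ^ suc s ≤ (m /2^ j) ^ suc s
    halving j = 2*m≤n⇒2*m^[1+k]≤n^[1+k] {m /2^ suc j} s (2*[m/2^[1+j]]≤m/2^j m j)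
    split : ∀ j → (2 ^ j) ^ a * (m /2^ j) ^ suc (a + s) ≤ m ^ a * (m /2^ j) ^ suc s
    split j = begin
      (2 ^ j) ^ a * (m /2^ j) ^ suc (a + s)           ≡⟨ cong (λ e → (2 ^ j) ^ a * (m /2^ j) ^ e) (+-suc a s) ⟨
      (2 ^ j) ^ a * (m /2^ j) ^ (a + suc s)           ≡⟨ cong ((2 ^ j) ^ a *_) (^-distribˡ-+-* (m /2^ j) a (suc s)) ⟩
      (2 ^ j) ^ a * ((m /2^ j) ^ a * (m /2^ j) ^ suc s) ≡⟨ *-assoc ((2 ^ j) ^ a) _ _ ⟨
      (2 ^ j) ^ a * (m /2^ j) ^ a * (m /2^ j) ^ suc s ≤⟨ *-monoˡ-≤ _ ([2^j]^a*[m/2^j]^a≤m^a m j a) ⟩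
      m ^ a * (m /2^ j) ^ suc s                       ∎

∑≤-dyadic-flat : ∀ m a J → ∑≤ J (λ j → (2 ^ j) ^ a * (m /2^ j) ^ a) ≤ suc J * m ^ a
∑≤-dyadic-flat m a J =
  ≤-trans (∑≤-mono-≤ J (λ j _ → [2^j]^a*[m/2^j]^a≤m^a m j a)) (≤-reflexive (∑≤-const J (m ^ a)))

∑≤-dyadic-shallow : ∀ m b s J → 2 ^ J ≤ m →
  ∑≤ J (λ j → (2 ^ j) ^ suc (b + s) * (m /2^ j) ^ b) ≤ 2 * m ^ suc (b + s)
∑≤-dyadic-shallow m b s J 2^J≤m = begin
  ∑≤ J (λ j → (2 ^ j) ^ suc (b + s) * (m /2^ j) ^ b) ≤⟨ ∑≤-mono-≤ J (λ j _ → split j) ⟩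
  ∑≤ J (λ j → m ^ b * (2 ^ j) ^ suc s)               ≡⟨ ∑≤-distribˡ-* J (m ^ b) _ ⟩
  m ^ b * ∑≤ J (λ j → (2 ^ j) ^ suc s)               ≤⟨ *-monoʳ-≤ (m ^ b) (∑≤-doubling J (λ j → 2*m≤n⇒2*m^[1+k]≤n^[1+k] {2 ^ j} s ≤-refl)) ⟩
  m ^ b * (2 * (2 ^ J) ^ suc s)                      ≤⟨ *-monoʳ-≤ (m ^ b) (*-monoʳ-≤ 2 (^-monoˡ-≤ (suc s) 2^J≤m)) ⟩
  m ^ b * (2 * m ^ suc s)                            ≡⟨ m^a*[2*m^b]≡2*m^[a+b] m b (suc s) ⟩
  2 * m ^ (b + suc s)                                ≡⟨ cong (λ e → 2 * m ^ e) (+-suc b s) ⟩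
  2 * m ^ suc (b + s)                                ∎
  where
    open ≤-Reasoning
    split : ∀ j → (2 ^ j) ^ suc (b + s) * (m /2^ j) ^ b ≤ m ^ b * (2 ^ j) ^ suc s
    split j = begin
      (2 ^ j) ^ suc (b + s) * (m /2^ j) ^ b           ≡⟨ cong (λ e → (2 ^ j) ^ e * (m /2^ j) ^ b) (+-suc b s) ⟨
      (2 ^ j) ^ (b + suc s) * (m /2^ j) ^ b           ≡⟨ cong (_* (m /2^ j) ^ b) (^-distribˡ-+-* (2 ^ j) b (suc s)) ⟩
      (2 ^ j) ^ b * (2 ^ j) ^ suc s * (m /2^ j) ^ b   ≡⟨ lemma ((2 ^ j) ^ b) ((2 ^ j) ^ suc s) ((m /2^ j) ^ b) ⟩
      (2 ^ j) ^ b * (m /2^ j) ^ b * (2 ^ j) ^ suc s   ≤⟨ *-monoˡ-≤ _ ([2^j]^a*[m/2^j]^a≤m^a m j b) ⟩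
      m ^ b * (2 ^ j) ^ suc s                         ∎
      where
        lemma : ∀ x y z → x * y * z ≡ x * z * y
        lemma = solve-∀

∈-─⁺ : ∀ {x z : A} (ys : List A) (x∈ys : x ∈ ys) → z ∈ ys → z ≢ x → z ∈ ys ─ x∈ys
∈-─⁺ (_ ∷ _)  (here refl) (here refl) z≢x = contradiction refl z≢x
∈-─⁺ (_ ∷ _)  (here refl) (there z∈ys) _  = z∈ys
∈-─⁺ (_ ∷ _)  (there _)   (here z≡y)   _  = here z≡y
∈-─⁺ (_ ∷ ys) (there x∈ys) (there z∈ys) z≢x = there (∈-─⁺ ys x∈ys z∈ys z≢x)

length-≤-by-encoding : (_encodes_ : B → A → Set) → (∀ y {x x′} → y encodes x → y encodes x′ → x ≡ x′) →
  ∀ {xs ys} → Unique xs → (∀ {x} → x ∈ xs → ∃[ y ] y ∈ ys × y encodes x) → length xs ≤ length ys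
length-≤-by-encoding _         _          {[]}     _              _      = z≤n
length-≤-by-encoding _encodes_ decodable {x ∷ xs} {ys} (x∉xs ∷ uniq) encode
  with y , y∈ys , y↦x ← encode (here refl) = begin
    suc (length xs)          ≤⟨ s≤s (length-≤-by-encoding _encodes_ decodable uniq encode′) ⟩
    suc (length (ys ─ y∈ys)) ≡⟨ length-removeAt′ ys _ ⟨
    length ys                ∎
  where
    open ≤-Reasoning
    encode′ : ∀ {z} → z ∈ xs → ∃[ y′ ] y′ ∈ ys ─ y∈ys × y′ encodes z
    encode′ z∈xs with y′ , y′∈ys , y′↦z ← encode (there z∈xs) =
      y′ , ∈-─⁺ ys y∈ys y′∈ys (λ { refl → All.lookup x∉xs z∈xs (decodable y y↦x y′↦z) }) , y′↦z

length-cartesianProductWith : (f : A → B → C) (xs : List A) (ys : List B) →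
  length (cartesianProductWith f xs ys) ≡ length xs * length ys
length-cartesianProductWith f []       ys = refl
length-cartesianProductWith f (x ∷ xs) ys = begin
  length (map (f x) ys ++ cartesianProductWith f xs ys)         ≡⟨ length-++ (map (f x) ys) ⟩
  length (map (f x) ys) + length (cartesianProductWith f xs ys) ≡⟨ cong₂ _+_ (length-map (f x) ys) (length-cartesianProductWith f xs ys) ⟩
  length ys + length xs * length ys                             ∎
  where open ≡-Reasoning

length-allFin : ∀ m → length (allFin m) ≡ m
length-allFin m = length-tabulate {n = m} (λ i → i)

vectorsOver : List A → (n : ℕ) → List (Vec A n)
vectorsOver xs zero    = [] ∷ []
vectorsOver xs (suc n) = cartesianProductWith _∷_ xs (vectorsOver xs n)

length-vectorsOver : (xs : List A) (n : ℕ) → length (vectorsOver xs n) ≡ length xs ^ n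
length-vectorsOver xs zero    = refl
length-vectorsOver xs (suc n) =
  trans (length-cartesianProductWith _∷_ xs (vectorsOver xs n)) (cong (length xs *_) (length-vectorsOver xs n))

∈-vectorsOver⁺ : ∀ {xs : List A} {n} (v : Vec A n) → (∀ i → lookup v i ∈ xs) → v ∈ vectorsOver xs n
∈-vectorsOver⁺ []      _      = here refl
∈-vectorsOver⁺ (x ∷ v) v⊆xs =
  ∈-cartesianProductWith⁺ _∷_ (v⊆xs zero) (∈-vectorsOver⁺ v (v⊆xs ∘ suc))

intsWithin : ℕ → List ℤ
intsWithin R = map ℤ.+_ (upTo (suc R)) ++ map -[1+_] (upTo R)

length-intsWithin : ∀ R → length (intsWithin R) ≡ 2 * R + 1
length-intsWithin R = begin
  length (map ℤ.+_ (upTo (suc R)) ++ map -[1+_] (upTo R))        ≡⟨ length-++ (map ℤ.+_ (upTo (suc R))) ⟩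
  length (map ℤ.+_ (upTo (suc R))) + length (map -[1+_] (upTo R)) ≡⟨ cong₂ _+_ (length-map ℤ.+_ (upTo (suc R))) (length-map -[1+_] (upTo R)) ⟩
  length (upTo (suc R)) + length (upTo R)                       ≡⟨ cong₂ _+_ (length-upTo (suc R)) (length-upTo R) ⟩
  suc R + R                                                     ≡⟨ lemma R ⟩
  2 * R + 1                                                     ∎
  where
    open ≡-Reasoning
    lemma : ∀ R → suc R + R ≡ 2 * R + 1
    lemma = solve-∀

∈-intsWithin⁺ : ∀ {R} z → ∣ z ∣ ≤ R → z ∈ intsWithin R
∈-intsWithin⁺         (ℤ.+ n)    n≤R = ∈-++⁺ˡ (∈-map⁺ ℤ.+_ (∈-upTo⁺ (s≤s n≤R)))
∈-intsWithin⁺ {R} -[1+ n ] n<R = ∈-++⁺ʳ (map ℤ.+_ (upTo (suc R))) (∈-map⁺ -[1+_] (∈-upTo⁺ n<R))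

concat≤ : ℕ → (ℕ → List A) → List A
concat≤ zero    xss = xss 0
concat≤ (suc J) xss = xss 0 ++ concat≤ J (xss ∘ suc)

length-concat≤ : (J : ℕ) (xss : ℕ → List A) → length (concat≤ J xss) ≡ ∑≤ J (length ∘ xss)
length-concat≤ zero    xss = refl
length-concat≤ (suc J) xss = trans (length-++ (xss 0)) (cong (_+_ (length (xss 0))) (length-concat≤ J (xss ∘ suc)))

∈-concat≤⁺ : {x : A} (J : ℕ) (xss : ℕ → List A) {j : ℕ} → j ≤ J → x ∈ xss j → x ∈ concat≤ J xss
∈-concat≤⁺ zero    xss {zero}  _         x∈xs = x∈xs
∈-concat≤⁺ (suc J) xss {zero}  _         x∈xs = ∈-++⁺ˡ x∈xs
∈-concat≤⁺ (suc J) xss {suc j} (s≤s j≤J) x∈xs = ∈-++⁺ʳ (xss 0) (∈-concat≤⁺ J (xss ∘ suc) j≤J x∈xs)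

ι : ℕ → ℚ
ι n = ℤ.+ n ℚ./ 1

private
  toℚᵘ-ι : ∀ n → toℚᵘ (ι n) ℚᵘ.≃ mkℚᵘ (ℤ.+ n) 0
  toℚᵘ-ι n = toℚᵘ-fromℚᵘ (mkℚᵘ (ℤ.+ n) 0)

ι-homo-+ : ∀ m n → ι (m + n) ≡ ι m ℚ.+ ι n
ι-homo-+ m n = toℚᵘ-injective (ℚᵘ.≃-trans (toℚᵘ-ι (m + n)) (ℚᵘ.≃-trans integral
  (ℚᵘ.≃-sym (ℚᵘ.≃-trans (toℚᵘ-homo-+ (ι m) (ι n)) (ℚᵘ.+-cong (toℚᵘ-ι m) (toℚᵘ-ι n))))))
  where
    integral : mkℚᵘ (ℤ.+ (m + n)) 0 ℚᵘ.≃ mkℚᵘ (ℤ.+ m) 0 ℚᵘ.+ mkℚᵘ (ℤ.+ n) 0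
    integral = *≡* (cong (ℤ._* ℤ.+ 1) (trans (ℤ.pos-+ m n)
      (sym (cong₂ ℤ._+_ (ℤ.*-identityʳ (ℤ.+ m)) (ℤ.*-identityʳ (ℤ.+ n))))))

ι-homo-* : ∀ m n → ι (m * n) ≡ ι m ℚ.* ι n
ι-homo-* m n = toℚᵘ-injective (ℚᵘ.≃-trans (toℚᵘ-ι (m * n)) (ℚᵘ.≃-trans integral
  (ℚᵘ.≃-sym (ℚᵘ.≃-trans (toℚᵘ-homo-* (ι m) (ι n)) (ℚᵘ.*-cong (toℚᵘ-ι m) (toℚᵘ-ι n))))))
  where
    integral : mkℚᵘ (ℤ.+ (m * n)) 0 ℚᵘ.≃ mkℚᵘ (ℤ.+ m) 0 ℚᵘ.* mkℚᵘ (ℤ.+ n) 0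
    integral = *≡* (cong (ℤ._* ℤ.+ 1) (ℤ.pos-* m n))

ι-injective : ∀ {m n} → ι m ≡ ι n → m ≡ n
ι-injective {m} {n} ιm≡ιn
  with *≡* eq ← ℚᵘ.≃-trans (ℚᵘ.≃-sym (toℚᵘ-ι m)) (ℚᵘ.≃-trans (ℚᵘ.≃-reflexive (cong toℚᵘ ιm≡ιn)) (toℚᵘ-ι n))
  = ℤ.+-injective (trans (sym (ℤ.*-identityʳ (ℤ.+ m))) (trans eq (ℤ.*-identityʳ (ℤ.+ n))))

-- Three points on a line have a vanishing determinant |1 1 1; x₀ xᵢ xⱼ; y₀ yᵢ yⱼ|. Its negative terms
-- are kept on the right-hand side, so that the identity can be transferred to ℕ.
affine-det : ∀ {I B : Set} (F : I → B → ℚ) (a u : B → ℚ) (s : I → ℚ) →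
  (∀ i b → F i b ≡ a b ℚ.+ s i ℚ.* u b) → ∀ i₀ i j b c →
  F i c ℚ.* F j b ℚ.+ F i b ℚ.* F i₀ c ℚ.+ F i₀ b ℚ.* F j c ≡
  F i c ℚ.* F i₀ b ℚ.+ F i₀ c ℚ.* F j b ℚ.+ F i b ℚ.* F j c
affine-det F a u s onLine i₀ i j b c
  rewrite onLine i c | onLine j b | onLine i b | onLine i₀ c | onLine i₀ b | onLine j c
  = solve 7 (λ ab ac ub uc s₀ sᵢ sⱼ →
      let x t = ac :+ t :* uc
          y t = ab :+ t :* ub
      in x sᵢ :* y sⱼ :+ y sᵢ :* x s₀ :+ y s₀ :* x sⱼ := x sᵢ :* y s₀ :+ x s₀ :* y sⱼ :+ y sᵢ :* x sⱼ)
      refl (a b) (a c) (u b) (u c) (s i₀) (s i) (s j)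
  where open +-*-Solver

coord : ∀ {d k m} → Tuple d k m → Fin k → Fin d → ℕ
coord T i b = toℕ (lookup (lookup T i) b)

collinear⇒det : ∀ {d k m} (T : Tuple d k m) → Collinear T → ∀ i₀ i j b c →
  coord T i c * coord T j b + coord T i b * coord T i₀ c + coord T i₀ b * coord T j c ≡
  coord T i c * coord T i₀ b + coord T i₀ c * coord T j b + coord T i b * coord T j c
collinear⇒det T (a , u , _ , onLine) i₀ i j b c = ι-injective (begin
  ι (X i c * X j b + X i b * X i₀ c + X i₀ b * X j c)
    ≡⟨ ι-homo-∑₃ (X i c) (X j b) (X i b) (X i₀ c) (X i₀ b) (X j c) ⟩
  ι (X i c) ℚ.* ι (X j b) ℚ.+ ι (X i b) ℚ.* ι (X i₀ c) ℚ.+ ι (X i₀ b) ℚ.* ι (X j c)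
    ≡⟨ affine-det (λ i b → ι (X i b)) (lookup a) (lookup u) (λ i → proj₁ (onLine i)) ι-coord i₀ i j b c ⟩
  ι (X i c) ℚ.* ι (X i₀ b) ℚ.+ ι (X i₀ c) ℚ.* ι (X j b) ℚ.+ ι (X i b) ℚ.* ι (X j c)
    ≡⟨ ι-homo-∑₃ (X i c) (X i₀ b) (X i₀ c) (X j b) (X i b) (X j c) ⟨
  ι (X i c * X i₀ b + X i₀ c * X j b + X i b * X j c) ∎)
  where
    open ≡-Reasoning
    X : Fin _ → Fin _ → ℕ
    X = coord T
    ι-homo-∑₃ : ∀ x₁ y₁ x₂ y₂ x₃ y₃ → ι (x₁ * y₁ + x₂ * y₂ + x₃ * y₃) ≡
                ι x₁ ℚ.* ι y₁ ℚ.+ ι x₂ ℚ.* ι y₂ ℚ.+ ι x₃ ℚ.* ι y₃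
    ι-homo-∑₃ x₁ y₁ x₂ y₂ x₃ y₃ = begin
      ι (x₁ * y₁ + x₂ * y₂ + x₃ * y₃)
        ≡⟨ trans (ι-homo-+ (x₁ * y₁ + x₂ * y₂) (x₃ * y₃)) (cong (ℚ._+ ι (x₃ * y₃)) (ι-homo-+ (x₁ * y₁) (x₂ * y₂))) ⟩
      ι (x₁ * y₁) ℚ.+ ι (x₂ * y₂) ℚ.+ ι (x₃ * y₃)
        ≡⟨ cong₂ ℚ._+_ (cong₂ ℚ._+_ (ι-homo-* x₁ y₁) (ι-homo-* x₂ y₂)) (ι-homo-* x₃ y₃) ⟩
      ι x₁ ℚ.* ι y₁ ℚ.+ ι x₂ ℚ.* ι y₂ ℚ.+ ι x₃ ℚ.* ι y₃ ∎
    ι-coord : ∀ i b → ι (X i b) ≡ lookup a b ℚ.+ proj₁ (onLine i) ℚ.* lookup u b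
    ι-coord i b = begin
      ι (X i b)                                                        ≡⟨ lookup-map b _ (lookup T i) ⟨
      lookup (toℚᵈ (lookup T i)) b                                     ≡⟨ cong (λ x → lookup x b) (proj₂ (onLine i)) ⟩
      lookup (Vec.zipWith ℚ._+_ a (Vec.map (proj₁ (onLine i) ℚ.*_) u)) b ≡⟨ lookup-zipWith _ b a _ ⟩
      lookup a b ℚ.+ lookup (Vec.map (proj₁ (onLine i) ℚ.*_) u) b ≡⟨ cong (lookup a b ℚ.+_) (lookup-map b _ u) ⟩
      lookup a b ℚ.+ proj₁ (onLine i) ℚ.* lookup u b                   ∎

Δ : ∀ {d k m} → Tuple d (suc k) m → Fin (suc k) → Fin d → ℤ
Δ T i b = ℤ.+ coord T i b ℤ.- ℤ.+ coord T zero b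

collinear⇒Δ-parallel : ∀ {d k m} (T : Tuple d (suc k) m) → Collinear T → ∀ i j b c →
  Δ T i c ℤ.* Δ T j b ≡ Δ T i b ℤ.* Δ T j c
collinear⇒Δ-parallel T col i j b c = ℤ.i-j≡0⇒i≡j _ _ (begin
  Δ T i c ℤ.* Δ T j b ℤ.- Δ T i b ℤ.* Δ T j c
    ≡⟨ identity (x i c) (x j b) (x i b) (x zero c) (x zero b) (x j c) ⟩
  ∑₃ (x i c) (x j b) (x i b) (x zero c) (x zero b) (x j c) ℤ.- ∑₃ (x i c) (x zero b) (x zero c) (x j b) (x i b) (x j c)
    ≡⟨ ℤ.i≡j⇒i-j≡0 det ⟩
  ℤ.+ 0 ∎)
  where
    open ≡-Reasoning
    X : Fin _ → Fin _ → ℕ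
    X = coord T
    x : Fin _ → Fin _ → ℤ
    x i b = ℤ.+ X i b
    ∑₃ : ℤ → ℤ → ℤ → ℤ → ℤ → ℤ → ℤ
    ∑₃ x₁ y₁ x₂ y₂ x₃ y₃ = x₁ ℤ.* y₁ ℤ.+ x₂ ℤ.* y₂ ℤ.+ x₃ ℤ.* y₃
    identity : ∀ xic xjb xib x0c x0b xjc →
      (xic ℤ.- x0c) ℤ.* (xjb ℤ.- x0b) ℤ.- (xib ℤ.- x0b) ℤ.* (xjc ℤ.- x0c) ≡
      (xic ℤ.* xjb ℤ.+ xib ℤ.* x0c ℤ.+ x0b ℤ.* xjc) ℤ.- (xic ℤ.* x0b ℤ.+ x0c ℤ.* xjb ℤ.+ xib ℤ.* xjc)
    identity = solve-∀ℤ
    +-homo-∑₃ : ∀ x₁ y₁ x₂ y₂ x₃ y₃ →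
      ℤ.+ (x₁ * y₁ + x₂ * y₂ + x₃ * y₃) ≡ ∑₃ (ℤ.+ x₁) (ℤ.+ y₁) (ℤ.+ x₂) (ℤ.+ y₂) (ℤ.+ x₃) (ℤ.+ y₃)
    +-homo-∑₃ x₁ y₁ x₂ y₂ x₃ y₃ =
      trans (ℤ.pos-+ (x₁ * y₁ + x₂ * y₂) (x₃ * y₃)) (cong₂ ℤ._+_ (trans (ℤ.pos-+ (x₁ * y₁) (x₂ * y₂)) (cong₂ ℤ._+_ (ℤ.pos-* x₁ y₁) (ℤ.pos-* x₂ y₂))) (ℤ.pos-* x₃ y₃))
    det : ∑₃ (x i c) (x j b) (x i b) (x zero c) (x zero b) (x j c) ≡ ∑₃ (x i c) (x zero b) (x zero c) (x j b) (x i b) (x j c)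
    det = trans (sym (+-homo-∑₃ (X i c) (X j b) (X i b) (X zero c) (X zero b) (X j c)))
      (trans (cong ℤ.+_ (collinear⇒det T col zero i j b c)) (+-homo-∑₃ (X i c) (X zero b) (X zero c) (X j b) (X i b) (X j c)))

∣Δ∣<m : ∀ {d k m} (T : Tuple d (suc k) m) i b → ∣ Δ T i b ∣ < m
∣Δ∣<m T i b = begin-strict
  ∣ Δ T i b ∣                       ≡⟨ cong ∣_∣ (ℤ.m-n≡m⊖n (coord T i b) (coord T zero b)) ⟩
  ∣ coord T i b ⊖ coord T zero b ∣  ≤⟨ ℤ.∣m⊝n∣≤m⊔n (coord T i b) (coord T zero b) ⟩
  coord T i b ⊔ coord T zero b      <⟨ ⊔-lub (toℕ<n (lookup (lookup T i) b)) (toℕ<n (lookup (lookup T zero) b)) ⟩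
  _                                 ∎
  where open ≤-Reasoning

distinct⇒Δ₁≢0 : ∀ {d n m} (T : Tuple d (suc (suc n)) m) → Distinct T → ¬ (∀ b → Δ T (suc zero) b ≡ 0ℤ)
distinct⇒Δ₁≢0 T distinct Δ₁≡0 = distinct (suc zero) zero (λ ())
  (Pointwise-≡⇒≡ (ext λ b → toℕ-injective (ℤ.+-injective (ℤ.i-j≡0⇒i≡j _ _ (Δ₁≡0 b)))))

gcdAll : ∀ {d} → (Fin d → ℕ) → ℕ
gcdAll {zero}  f = 0
gcdAll {suc d} f = gcd (f zero) (gcdAll (f ∘ suc))

gcdAll-∣ : ∀ {d} (f : Fin d → ℕ) b → gcdAll f ∣ f b
gcdAll-∣ f zero    = gcd[m,n]∣m (f zero) (gcdAll (f ∘ suc))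
gcdAll-∣ f (suc b) = ∣-trans (gcd[m,n]∣n (f zero) (gcdAll (f ∘ suc))) (gcdAll-∣ (f ∘ suc) b)

gcdAll-greatest : ∀ {d} (f : Fin d → ℕ) {n} → (∀ b → n ∣ f b) → n ∣ gcdAll f
gcdAll-greatest {zero}  f {n} _    = n ∣0
gcdAll-greatest {suc d} f     n∣f = gcd-greatest (n∣f zero) (gcdAll-greatest (f ∘ suc) (n∣f ∘ suc))

c*gcdAll[f]≡gcdAll[c*f] : ∀ {d} c (f : Fin d → ℕ) → c * gcdAll f ≡ gcdAll (λ b → c * f b)
c*gcdAll[f]≡gcdAll[c*f] {zero}  c f = *-zeroʳ c
c*gcdAll[f]≡gcdAll[c*f] {suc d} c f = trans (c*gcd[m,n]≡gcd[cm,cn] c (f zero) _)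
  (cong (gcd (c * f zero)) (c*gcdAll[f]≡gcdAll[c*f] c (f ∘ suc)))

gcdAll-cong : ∀ {d} {f g : Fin d → ℕ} → (∀ b → f b ≡ g b) → gcdAll f ≡ gcdAll g
gcdAll-cong {zero}  _   = refl
gcdAll-cong {suc d} f≗g = cong₂ gcd (f≗g zero) (gcdAll-cong (f≗g ∘ suc))

Primitive : ∀ {d} → (Fin d → ℤ) → Set
Primitive v = gcdAll (∣_∣ ∘ v) ≡ 1

primitive-part : ∀ {d} (w : Fin d → ℤ) c → w c ≢ 0ℤ →
  Σ[ g ∈ ℕ ] Σ[ v ∈ (Fin d → ℤ) ] NonZero g × (∀ b → w b ≡ v b ℤ.* ℤ.+ g) × Primitive v
primitive-part w c wc≢0 = g , v , g≢0 , w≡v*g , gcd[v]≡1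
  where
    g : ℕ
    g = gcdAll (∣_∣ ∘ w)
    g∣w : ∀ b → ℤ.+ g ℤ.∣ w b
    g∣w b = ℤ.∣ᵤ⇒∣ (gcdAll-∣ (∣_∣ ∘ w) b)
    v : Fin _ → ℤ
    v b = ℤ._∣_.quotient (g∣w b)
    w≡v*g : ∀ b → w b ≡ v b ℤ.* ℤ.+ g
    w≡v*g b = ℤ._∣_.equality (g∣w b)
    g≢0 : NonZero g
    g≢0 = ≢-nonZero λ g≡0 → wc≢0 (ℤ.∣i∣≡0⇒i≡0 (0∣⇒≡0 (subst (_∣ ∣ w c ∣) g≡0 (gcdAll-∣ (∣_∣ ∘ w) c))))
    ∣w∣≡g*∣v∣ : ∀ b → ∣ w b ∣ ≡ g * ∣ v b ∣
    ∣w∣≡g*∣v∣ b = trans (cong ∣_∣ (w≡v*g b)) (trans (ℤ.abs-* (v b) (ℤ.+ g)) (*-comm ∣ v b ∣ g))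
    gcd[v]≡1 : gcdAll (∣_∣ ∘ v) ≡ 1
    gcd[v]≡1 = *-cancelˡ-≡ _ 1 g {{g≢0}} (begin
      g * gcdAll (∣_∣ ∘ v)                ≡⟨ c*gcdAll[f]≡gcdAll[c*f] g (∣_∣ ∘ v) ⟩
      gcdAll (λ b → g * ∣ v b ∣)          ≡⟨ gcdAll-cong ∣w∣≡g*∣v∣ ⟨
      g                                     ≡⟨ *-identityʳ g ⟨
      g * 1                               ∎)
      where open ≡-Reasoning

parallel-to-primitive⇒multiple : ∀ {d} {v : Fin d → ℤ} c → Primitive v → v c ≢ 0ℤ →
  (y : Fin d → ℤ) → (∀ b → v c ℤ.* y b ≡ v b ℤ.* y c) → ∃[ t ] ∀ b → y b ≡ t ℤ.* v b
parallel-to-primitive⇒multiple {v = v} c gcd[v]≡1 vc≢0 y parallel = t , y≡t*v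
  where
    instance
      vc-nonZero : ℤ.NonZero (v c)
      vc-nonZero = ℤ.≢-nonZero vc≢0
    ∣vc∣∣∣yc∣*∣vb∣ : ∀ b → ∣ v c ∣ ∣ ∣ y c ∣ * ∣ v b ∣
    ∣vc∣∣∣yc∣*∣vb∣ b = divides ∣ y b ∣ (begin
      ∣ y c ∣ * ∣ v b ∣   ≡⟨ *-comm ∣ y c ∣ ∣ v b ∣ ⟩
      ∣ v b ∣ * ∣ y c ∣   ≡⟨ ℤ.abs-* (v b) (y c) ⟨
      ∣ v b ℤ.* y c ∣       ≡⟨ cong ∣_∣ (parallel b) ⟨
      ∣ v c ℤ.* y b ∣       ≡⟨ ℤ.abs-* (v c) (y b) ⟩
      ∣ v c ∣ * ∣ y b ∣   ≡⟨ *-comm ∣ v c ∣ ∣ y b ∣ ⟩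
      ∣ y b ∣ * ∣ v c ∣   ∎)
      where open ≡-Reasoning
    ∣yc∣*gcd[v]≡∣yc∣ : gcdAll (λ b → ∣ y c ∣ * ∣ v b ∣) ≡ ∣ y c ∣
    ∣yc∣*gcd[v]≡∣yc∣ = trans (sym (c*gcdAll[f]≡gcdAll[c*f] ∣ y c ∣ (∣_∣ ∘ v)))
      (trans (cong (∣ y c ∣ *_) gcd[v]≡1) (*-identityʳ ∣ y c ∣))
    vc∣yc : v c ℤ.∣ y c
    vc∣yc = ℤ.∣ᵤ⇒∣ (subst (∣ v c ∣ ∣_) ∣yc∣*gcd[v]≡∣yc∣ (gcdAll-greatest _ ∣vc∣∣∣yc∣*∣vb∣))
    t : ℤ
    t = ℤ._∣_.quotient vc∣yc
    y≡t*v : ∀ b → y b ≡ t ℤ.* v b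
    y≡t*v b = ℤ.*-cancelˡ-≡ (v c) (y b) (t ℤ.* v b) (begin
      v c ℤ.* y b           ≡⟨ parallel b ⟩
      v b ℤ.* y c           ≡⟨ cong (v b ℤ.*_) (ℤ._∣_.equality vc∣yc) ⟩
      v b ℤ.* (t ℤ.* v c)   ≡⟨ lemma (v b) t (v c) ⟩
      v c ℤ.* (t ℤ.* v b)   ∎)
      where
        open ≡-Reasoning
        lemma : ∀ x t z → x ℤ.* (t ℤ.* z) ≡ z ℤ.* (t ℤ.* x)
        lemma = solve-∀ℤ

primitive-direction : ∀ {d} (w : Fin d → ℤ) c → w c ≢ 0ℤ →
  Σ[ v ∈ (Fin d → ℤ) ] ((y : Fin d → ℤ) → (∀ b → w c ℤ.* y b ≡ w b ℤ.* y c) → ∃[ t ] ∀ b → y b ≡ t ℤ.* v b)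
primitive-direction w c wc≢0 with g , v , g≢0 , w≡v*g , v-primitive ← primitive-part w c wc≢0 =
  v , λ y parallel → parallel-to-primitive⇒multiple c v-primitive vc≢0 y (parallel′ y parallel)
  where
    vc≢0 : v c ≢ 0ℤ
    vc≢0 vc≡0 = wc≢0 (trans (w≡v*g c) (cong (ℤ._* ℤ.+ g) vc≡0))
    parallel′ : (y : Fin _ → ℤ) → (∀ b → w c ℤ.* y b ≡ w b ℤ.* y c) → ∀ b → v c ℤ.* y b ≡ v b ℤ.* y c
    parallel′ y parallel b = ℤ.*-cancelʳ-≡ (v c ℤ.* y b) (v b ℤ.* y c) (ℤ.+ g) {{g≢0}} (begin
      v c ℤ.* y b ℤ.* ℤ.+ g   ≡⟨ lemma (v c) (y b) (ℤ.+ g) ⟩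
      v c ℤ.* ℤ.+ g ℤ.* y b   ≡⟨ cong₂ ℤ._*_ (w≡v*g c) refl ⟨
      w c ℤ.* y b           ≡⟨ parallel b ⟩
      w b ℤ.* y c           ≡⟨ cong₂ ℤ._*_ (w≡v*g b) refl ⟩
      v b ℤ.* ℤ.+ g ℤ.* y c   ≡⟨ lemma (v b) (y c) (ℤ.+ g) ⟨
      v b ℤ.* y c ℤ.* ℤ.+ g   ∎)
      where
        open ≡-Reasoning
        lemma : ∀ x y z → x ℤ.* y ℤ.* z ≡ x ℤ.* z ℤ.* y
        lemma = solve-∀ℤ

collinear⇒Δ-multiples : ∀ {d n m} (T : Tuple d (suc (suc n)) m) → CollinearTuple T →
  ∃[ c ] Δ T (suc zero) c ≢ 0ℤ ×
  Σ[ v ∈ (Fin d → ℤ) ] Σ[ t ∈ (Fin (suc n) → ℤ) ] ∀ i b → Δ T (suc i) b ≡ t i ℤ.* v b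
collinear⇒Δ-multiples T (distinct , collinear) = c , Δ₁c≢0 , v , (λ i → proj₁ (Δ≡t*v i)) , (λ i → proj₂ (Δ≡t*v i))
  where
    Δ₁ : Fin _ → ℤ
    Δ₁ = Δ T (suc zero)
    nonzero : ∃[ c ] Δ₁ c ≢ 0ℤ
    nonzero = ¬∀⟶∃¬ _ (λ b → Δ₁ b ≡ 0ℤ) (λ b → Δ₁ b ℤ.≟ 0ℤ) (distinct⇒Δ₁≢0 T distinct)
    c : Fin _
    c = proj₁ nonzero
    Δ₁c≢0 : Δ₁ c ≢ 0ℤ
    Δ₁c≢0 = proj₂ nonzero
    direction : Σ[ v ∈ (Fin _ → ℤ) ] ((y : Fin _ → ℤ) → (∀ b → Δ₁ c ℤ.* y b ≡ Δ₁ b ℤ.* y c) → ∃[ t ] ∀ b → y b ≡ t ℤ.* v b)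
    direction = primitive-direction Δ₁ c Δ₁c≢0
    v : Fin _ → ℤ
    v = proj₁ direction
    Δ≡t*v : ∀ i → ∃[ t ] ∀ b → Δ T (suc i) b ≡ t ℤ.* v b
    Δ≡t*v i = proj₂ direction (Δ T (suc i)) (λ b → collinear⇒Δ-parallel T collinear (suc zero) (suc i) b c)

Code : ℕ → ℕ → ℕ → Set
Code d n m = Point d m × Vec ℤ d × Vec ℤ n

_encodes_ : ∀ {d n m} → Code d n m → Tuple d (suc n) m → Set
(p , v , t) encodes T = lookup T zero ≡ p × (∀ i b → Δ T (suc i) b ≡ lookup t i ℤ.* lookup v b)

encodes-functional : ∀ {d n m} (code : Code d n m) {T T′} → code encodes T → code encodes T′ → T ≡ T′
encodes-functional _ {T} {T′} (T₀≡p , ΔT≡t*v) (T′₀≡p , ΔT′≡t*v) = Pointwise-≡⇒≡ (ext same-point)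
  where
    x≡[x-y]+y : ∀ x y → x ≡ x ℤ.- y ℤ.+ y
    x≡[x-y]+y = solve-∀ℤ
    same-point : ∀ i → lookup T i ≡ lookup T′ i
    same-point zero    = trans T₀≡p (sym T′₀≡p)
    same-point (suc i) = Pointwise-≡⇒≡ (ext λ b → toℕ-injective (ℤ.+-injective (begin
      ℤ.+ coord T (suc i) b                   ≡⟨ x≡[x-y]+y (ℤ.+ coord T (suc i) b) (ℤ.+ coord T zero b) ⟩
      Δ T (suc i) b ℤ.+ ℤ.+ coord T zero b    ≡⟨ cong₂ ℤ._+_ (trans (ΔT≡t*v i b) (sym (ΔT′≡t*v i b)))
                                                          (cong (λ p → ℤ.+ toℕ (lookup p b)) (same-point zero)) ⟩
      Δ T′ (suc i) b ℤ.+ ℤ.+ coord T′ zero b  ≡⟨ x≡[x-y]+y (ℤ.+ coord T′ (suc i) b) (ℤ.+ coord T′ zero b) ⟨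
      ℤ.+ coord T′ (suc i) b                  ∎)))
      where open ≡-Reasoning

codesAtScale : ∀ d n m → ℕ → List (Code d n m)
codesAtScale d n m j = cartesianProduct (vectorsOver (allFin m) d)
  (cartesianProduct (vectorsOver (intsWithin (2 ^ suc j)) d) (vectorsOver (intsWithin (m /2^ j)) n))

blockSize : ℕ → ℕ → ℕ → ℕ → ℕ
blockSize d n m j = m ^ d * ((2 * 2 ^ suc j + 1) ^ d * (2 * (m /2^ j) + 1) ^ n)

length-codesAtScale : ∀ d n m j → length (codesAtScale d n m j) ≡ blockSize d n m j
length-codesAtScale d n m j = begin
  length (codesAtScale d n m j)
    ≡⟨ length-cartesianProductWith _,_ points (cartesianProduct directions multipliers) ⟩
  length points * length (cartesianProduct directions multipliers)
    ≡⟨ cong (length points *_) (length-cartesianProductWith _,_ directions multipliers) ⟩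
  length points * (length directions * length multipliers)
    ≡⟨ cong₂ _*_ (trans (length-vectorsOver (allFin m) d) (cong (_^ d) (length-allFin m)))
         (cong₂ _*_ (trans (length-vectorsOver (intsWithin (2 ^ suc j)) d) (cong (_^ d) (length-intsWithin (2 ^ suc j))))
                    (trans (length-vectorsOver (intsWithin (m /2^ j)) n) (cong (_^ n) (length-intsWithin (m /2^ j))))) ⟩
  blockSize d n m j ∎
  where
    open ≡-Reasoning
    points : List (Point d m)
    points = vectorsOver (allFin m) d
    directions : List (Vec ℤ d)
    directions = vectorsOver (intsWithin (2 ^ suc j)) d
    multipliers : List (Vec ℤ n)
    multipliers = vectorsOver (intsWithin (m /2^ j)) n

blockSize≤ : ∀ d n m j → 2 ^ j ≤ m →
  blockSize d n m j ≤ 5 ^ d * 3 ^ n * (m ^ d * ((2 ^ j) ^ d * (m /2^ j) ^ n))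
blockSize≤ d n m j 2^j≤m = begin
  m ^ d * ((2 * 2 ^ suc j + 1) ^ d * (2 * (m /2^ j) + 1) ^ n)
    ≤⟨ *-monoʳ-≤ (m ^ d) (*-mono-≤ (^-monoˡ-≤ d direction≤) (^-monoˡ-≤ n multiplier≤)) ⟩
  m ^ d * ((5 * 2 ^ j) ^ d * (3 * (m /2^ j)) ^ n)
    ≡⟨ cong₂ (λ x y → m ^ d * (x * y)) (^-distribʳ-* 5 (2 ^ j) d) (^-distribʳ-* 3 (m /2^ j) n) ⟩
  m ^ d * (5 ^ d * (2 ^ j) ^ d * (3 ^ n * (m /2^ j) ^ n))
    ≡⟨ lemma (m ^ d) (5 ^ d) ((2 ^ j) ^ d) (3 ^ n) ((m /2^ j) ^ n) ⟩
  5 ^ d * 3 ^ n * (m ^ d * ((2 ^ j) ^ d * (m /2^ j) ^ n)) ∎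
  where
    open ≤-Reasoning
    direction≤ : 2 * 2 ^ suc j + 1 ≤ 5 * 2 ^ j
    direction≤ = subst (λ x → x + 1 ≤ 5 * 2 ^ j) (*-assoc 2 2 (2 ^ j)) (k*n+1≤[1+k]*n 4 (m^n>0 2 j))
    multiplier≤ : 2 * (m /2^ j) + 1 ≤ 3 * (m /2^ j)
    multiplier≤ = k*n+1≤[1+k]*n 2 (2^j≤m⇒m/2^j>0 j 2^j≤m)
    lemma : ∀ a b c x y → a * (b * c * (x * y)) ≡ b * x * (a * (c * y))
    lemma = solve-∀

∑≤-blockSize≤ : ∀ d n m J → 2 ^ J ≤ m →
  ∑≤ J (blockSize d n m) ≤ 5 ^ d * 3 ^ n * (m ^ d * ∑≤ J (λ j → (2 ^ j) ^ d * (m /2^ j) ^ n))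
∑≤-blockSize≤ d n m J 2^J≤m = begin
  ∑≤ J (blockSize d n m)
    ≤⟨ ∑≤-mono-≤ J (λ j j≤J → blockSize≤ d n m j (≤-trans (^-monoʳ-≤ 2 j≤J) 2^J≤m)) ⟩
  ∑≤ J (λ j → K * (m ^ d * f j))  ≡⟨ ∑≤-distribˡ-* J K _ ⟩
  K * ∑≤ J (λ j → m ^ d * f j)    ≡⟨ cong (K *_) (∑≤-distribˡ-* J (m ^ d) f) ⟩
  K * (m ^ d * ∑≤ J f)            ∎
  where
    open ≤-Reasoning
    K : ℕ
    K = 5 ^ d * 3 ^ n
    f : ℕ → ℕ
    f j = (2 ^ j) ^ d * (m /2^ j) ^ n

multiples⇒scale : ∀ {d n m} J → m < 2 ^ suc J → (T : Tuple d (suc (suc n)) m) (c : Fin d) →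
  Δ T (suc zero) c ≢ 0ℤ → (v : Fin d → ℤ) (t : Fin (suc n) → ℤ) → (∀ i b → Δ T (suc i) b ≡ t i ℤ.* v b) →
  ∃[ j ] j ≤ J × (∀ b → ∣ v b ∣ ≤ 2 ^ suc j) × (∀ i → ∣ t i ∣ ≤ m /2^ j)
multiples⇒scale {d} {m = m} J m<2^[1+J] T c Δ₁c≢0 v t Δ≡t*v =
  j , j≤J , (λ b → ≤-trans (∣v∣≤r b) (<⇒≤ r<2^[1+j])) , (λ i → n*2^j≤m⇒n≤m/2^j j (<⇒≤ (∣t∣*2^j<m i)))
  where
    open ≤-Reasoning
    bmax : Fin d
    bmax = argmax (∣_∣ ∘ v) c (allFin d)
    r : ℕ
    r = ∣ v bmax ∣
    ∣v∣≤r : ∀ b → ∣ v b ∣ ≤ r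
    ∣v∣≤r b = All.lookup (f[xs]≤f[argmax] {f = ∣_∣ ∘ v} c (allFin d)) (∈-allFin b)
    t₀≢0 : t zero ≢ 0ℤ
    t₀≢0 t₀≡0 = Δ₁c≢0 (trans (Δ≡t*v zero c) (cong (ℤ._* v c) t₀≡0))
    vc≢0 : v c ≢ 0ℤ
    vc≢0 vc≡0 = Δ₁c≢0 (trans (Δ≡t*v zero c) (trans (cong (t zero ℤ.*_) vc≡0) (ℤ.*-zeroʳ (t zero))))
    1≤r : 1 ≤ r
    1≤r = ≤-trans (n≢0⇒n>0 (vc≢0 ∘ ℤ.∣i∣≡0⇒i≡0)) (f[⊥]≤f[argmax] {f = ∣_∣ ∘ v} c (allFin d))
    j : ℕ
    j = proj₁ (dyadic-scale r 1≤r)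
    2^j≤r : 2 ^ j ≤ r
    2^j≤r = proj₁ (proj₂ (dyadic-scale r 1≤r))
    r<2^[1+j] : r < 2 ^ suc j
    r<2^[1+j] = proj₂ (proj₂ (dyadic-scale r 1≤r))
    ∣t∣*2^j<m : ∀ i → ∣ t i ∣ * 2 ^ j < m
    ∣t∣*2^j<m i = begin-strict
      ∣ t i ∣ * 2 ^ j           ≤⟨ *-monoʳ-≤ ∣ t i ∣ 2^j≤r ⟩
      ∣ t i ∣ * ∣ v bmax ∣      ≡⟨ ℤ.abs-* (t i) (v bmax) ⟨
      ∣ t i ℤ.* v bmax ∣        ≡⟨ cong ∣_∣ (Δ≡t*v i bmax) ⟨
      ∣ Δ T (suc i) bmax ∣      <⟨ ∣Δ∣<m T (suc i) bmax ⟩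
      m                         ∎
    j≤J : j ≤ J
    j≤J = 2^j<2^[1+J]⇒j≤J (begin-strict
      2 ^ j                     ≤⟨ m≤n*m (2 ^ j) ∣ t zero ∣ {{≢-nonZero (t₀≢0 ∘ ℤ.∣i∣≡0⇒i≡0)}} ⟩
      ∣ t zero ∣ * 2 ^ j        <⟨ ∣t∣*2^j<m zero ⟩
      m                         <⟨ m<2^[1+J] ⟩
      2 ^ suc J                 ∎)

multiples⇒encoded : ∀ {d n m} J → m < 2 ^ suc J → (T : Tuple d (suc (suc n)) m) (c : Fin d) →
  Δ T (suc zero) c ≢ 0ℤ → (v : Fin d → ℤ) (t : Fin (suc n) → ℤ) → (∀ i b → Δ T (suc i) b ≡ t i ℤ.* v b) →
  ∃[ code ] code ∈ concat≤ J (codesAtScale d (suc n) m) × code encodes T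
multiples⇒encoded {d} {n} {m} J m<2^[1+J] T c Δ₁c≢0 v t Δ≡t*v =
  let j , j≤J , ∣v∣≤2^[1+j] , ∣t∣≤m/2^j = multiples⇒scale J m<2^[1+J] T c Δ₁c≢0 v t Δ≡t*v
      v∈ = λ b → subst (_∈ intsWithin (2 ^ suc j)) (sym (lookup∘tabulate v b)) (∈-intsWithin⁺ (v b) (∣v∣≤2^[1+j] b))
      t∈ = λ i → subst (_∈ intsWithin (m /2^ j)) (sym (lookup∘tabulate t i)) (∈-intsWithin⁺ (t i) (∣t∣≤m/2^j i))
  in (lookup T zero , tabulate v , tabulate t) ,
     ∈-concat≤⁺ J (codesAtScale d (suc n) m) j≤J
       (∈-cartesianProduct⁺ (∈-vectorsOver⁺ (lookup T zero) (λ b → ∈-allFin _))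
         (∈-cartesianProduct⁺ (∈-vectorsOver⁺ (tabulate v) v∈) (∈-vectorsOver⁺ (tabulate t) t∈))) ,
     refl , λ i b → trans (Δ≡t*v i b) (sym (cong₂ ℤ._*_ (lookup∘tabulate t i) (lookup∘tabulate v b)))

CountAtMost-∑blockSize : ∀ {d n m} J → m < 2 ^ suc J →
  CountAtMost d (suc (suc n)) m (∑≤ J (blockSize d (suc n) m))
CountAtMost-∑blockSize {d} {n} {m} J m<2^[1+J] L unique collinear = begin
  length L                                      ≤⟨ length-≤-by-encoding _encodes_ encodes-functional unique encode ⟩
  length (concat≤ J (codesAtScale d (suc n) m))   ≡⟨ length-concat≤ J (codesAtScale d (suc n) m) ⟩
  ∑≤ J (length ∘ codesAtScale d (suc n) m)        ≤⟨ ∑≤-mono-≤ J (λ j _ → ≤-reflexive (length-codesAtScale d (suc n) m j)) ⟩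
  ∑≤ J (blockSize d (suc n) m)                    ∎
  where
    open ≤-Reasoning
    encode : ∀ {T} → T ∈ L → ∃[ code ] code ∈ concat≤ J (codesAtScale d (suc n) m) × code encodes T
    encode {T} T∈L = let c , Δ₁c≢0 , v , t , Δ≡t*v = collinear⇒Δ-multiples T (All.lookup collinear T∈L) in
      multiples⇒encoded J m<2^[1+J] T c Δ₁c≢0 v t Δ≡t*v

CountAtMost-mono : ∀ {d k m B B′} → B ≤ B′ → CountAtMost d k m B → CountAtMost d k m B′
CountAtMost-mono B≤B′ count≤B L unique collinear = ≤-trans (count≤B L unique collinear) B≤B′

CountAtMost-dyadic : ∀ d n m → 1 ≤ m → ∃[ J ] 2 ^ J ≤ m ×
  CountAtMost d (suc (suc n)) m (5 ^ d * 3 ^ suc n * (m ^ d * ∑≤ J (λ j → (2 ^ j) ^ d * (m /2^ j) ^ suc n)))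
CountAtMost-dyadic d n m 1≤m with J , 2^J≤m , m<2^[1+J] ← dyadic-scale m 1≤m =
  J , 2^J≤m , CountAtMost-mono (∑≤-blockSize≤ d (suc n) m J 2^J≤m) (CountAtMost-∑blockSize J m<2^[1+J])

BigO-steep : ∀ d e → BigO d (suc (suc (d + e))) (λ m → m ^ (d + suc (suc (d + e)) ∸ 1))
BigO-steep d e = 2 * K , λ m 2≤m → let J , _ , count≤ = CountAtMost-dyadic d (d + e) m (<⇒≤ 2≤m) in
  CountAtMost-mono (begin
    K * (m ^ d * ∑≤ J (λ j → (2 ^ j) ^ d * (m /2^ j) ^ suc (d + e)))
      ≤⟨ *-monoʳ-≤ K (*-monoʳ-≤ (m ^ d) (∑≤-dyadic-steep m d e J)) ⟩
    K * (m ^ d * (2 * m ^ suc (d + e)))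
      ≡⟨ lemma K (m ^ d) (m ^ suc (d + e)) ⟩
    2 * K * (m ^ d * m ^ suc (d + e))
      ≡⟨ cong (2 * K *_) (^-distribˡ-+-* m d (suc (d + e))) ⟨
    2 * K * m ^ (d + suc (d + e))
      ≡⟨ cong (λ x → 2 * K * m ^ (x ∸ 1)) (+-suc d (suc (d + e))) ⟨
    2 * K * m ^ (d + suc (suc (d + e)) ∸ 1) ∎) count≤
  where
    open ≤-Reasoning
    K : ℕ
    K = 5 ^ d * 3 ^ suc (d + e)
    lemma : ∀ k x y → k * (x * (2 * y)) ≡ 2 * k * (x * y)
    lemma = solve-∀

BigO-critical : ∀ n → BigO (suc n) (suc (suc n)) (λ m → m ^ (suc n + suc (suc n) ∸ 1) * ⌊log₂ m ⌋)
BigO-critical n = 2 * K , λ m 2≤m → let J , 2^J≤m , count≤ = CountAtMost-dyadic d n m (<⇒≤ 2≤m) in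
  CountAtMost-mono (begin
    K * (m ^ d * ∑≤ J (λ j → (2 ^ j) ^ d * (m /2^ j) ^ d))
      ≤⟨ *-monoʳ-≤ K (*-monoʳ-≤ (m ^ d) (∑≤-dyadic-flat m d J)) ⟩
    K * (m ^ d * (suc J * m ^ d))
      ≤⟨ *-monoʳ-≤ K (*-monoʳ-≤ (m ^ d) (*-monoˡ-≤ (m ^ d) (2^J≤m⇒1+J≤2*⌊log₂m⌋ J 2≤m 2^J≤m))) ⟩
    K * (m ^ d * (2 * ⌊log₂ m ⌋ * m ^ d))
      ≡⟨ lemma K (m ^ d) ⌊log₂ m ⌋ ⟩
    2 * K * (m ^ d * m ^ d * ⌊log₂ m ⌋)
      ≡⟨ cong (λ x → 2 * K * (x * ⌊log₂ m ⌋)) (^-distribˡ-+-* m d d) ⟨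
    2 * K * (m ^ (d + d) * ⌊log₂ m ⌋)
      ≡⟨ cong (λ x → 2 * K * (m ^ (x ∸ 1) * ⌊log₂ m ⌋)) (+-suc d d) ⟨
    2 * K * (m ^ (d + suc d ∸ 1) * ⌊log₂ m ⌋) ∎) count≤
  where
    open ≤-Reasoning
    d : ℕ
    d = suc n
    K : ℕ
    K = 5 ^ d * 3 ^ d
    lemma : ∀ k x l → k * (x * (2 * l * x)) ≡ 2 * k * (x * x * l)
    lemma = solve-∀

BigO-shallow : ∀ n e → BigO (suc (suc n + e)) (suc (suc n)) (λ m → m ^ (2 * suc (suc n + e)))
BigO-shallow n e = 2 * K , λ m 2≤m → let J , 2^J≤m , count≤ = CountAtMost-dyadic d n m (<⇒≤ 2≤m) in
  CountAtMost-mono (begin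
    K * (m ^ d * ∑≤ J (λ j → (2 ^ j) ^ d * (m /2^ j) ^ suc n))
      ≤⟨ *-monoʳ-≤ K (*-monoʳ-≤ (m ^ d) (∑≤-dyadic-shallow m (suc n) e J 2^J≤m)) ⟩
    K * (m ^ d * (2 * m ^ d))
      ≡⟨ lemma K (m ^ d) ⟩
    2 * K * (m ^ d * m ^ d)
      ≡⟨ cong (2 * K *_) (^-distribˡ-+-* m d d) ⟨
    2 * K * m ^ (d + d)
      ≡⟨ cong (λ x → 2 * K * m ^ (d + x)) (+-identityʳ d) ⟨
    2 * K * m ^ (2 * d) ∎) count≤
  where
    open ≤-Reasoning
    d : ℕ
    d = suc (suc n + e)
    K : ℕ
    K = 5 ^ d * 3 ^ suc n
    lemma : ∀ k x → k * (x * (2 * x)) ≡ 2 * k * (x * x)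
    lemma = solve-∀

lemma2p1 : (d k : ℕ) → 2 ≤ d → 2 ≤ k →
    ((d + 2 ≤ k → BigO d k (λ m → m ^ (d + k ∸ 1)))
    × (k ≡ d + 1 → BigO d k (λ m → m ^ (d + k ∸ 1) * ⌊log₂ m ⌋))
    × (k ≤ d → BigO d k (λ m → m ^ (2 * d))))
lemma2p1 d k@(suc (suc n)) _ (s≤s (s≤s z≤n)) = steep , critical , shallow
  where
    steep : d + 2 ≤ k → BigO d k (λ m → m ^ (d + k ∸ 1))
    steep d+2≤k = subst (λ k → BigO d k (λ m → m ^ (d + k ∸ 1)))
      (trans (reassoc d (k ∸ (d + 2))) (m+[n∸m]≡n d+2≤k)) (BigO-steep d (k ∸ (d + 2)))
      where
        reassoc : ∀ d e → suc (suc (d + e)) ≡ d + 2 + e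
        reassoc = solve-∀
    critical : k ≡ d + 1 → BigO d k (λ m → m ^ (d + k ∸ 1) * ⌊log₂ m ⌋)
    critical k≡d+1 = subst (λ d → BigO d k (λ m → m ^ (d + k ∸ 1) * ⌊log₂ m ⌋))
      (suc-injective (trans k≡d+1 (+-comm d 1))) (BigO-critical n)
    shallow : k ≤ d → BigO d k (λ m → m ^ (2 * d))
    shallow k≤d = subst (λ d → BigO d k (λ m → m ^ (2 * d))) (m+[n∸m]≡n k≤d) (BigO-shallow n (d ∸ k))
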